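{- Let $H$ be a finite graph, $r,s\ge 1$ integers, and $(A_1,\dots,A_N)$ an $(r,s)$-protocol that clears $H$. If $H'$ is a subgraph of $H$ and $A'_i=A_i\cap V(H')$ for $1\le i\le N$, then the $(r,s)$-protocol $(A'_1,\dots,A'_N)$ clears $H'$.
   Context: Discrete-time immunization model. Fix integers $r,s\ge 1$ and a finite graph $H$. An $(r,s)$-protocol for $H$ is a finite sequence $(A_1,\dots,A_N)$ of subsets of $V(H)$ ($A_t$ is the set of vertices immunized at time-step $t$). At time-step $0$ every vertex is red. For each $t\ge 1$ every vertex lies in exactly one of $G_t^r,\dots,G_t^1$ (green), $Y_t^s,\dots,Y_t^1$ (yellow), $R_t$ (red), determined as follows: if $v\in A_t$ then $v\in G_t^r$. If $v\notin A_t$: if $v$ was red at time $t-1$ or $v\in Y_{t-1}^1$, then $v\in R_t$; if $v\in Y_{t-1}^i$ with $2\le i\le s$, then $v\in Y_t^{i-1}$; if $v\in G_{t-1}^i$ with $2\le i\le r$, then $v\in G_t^{i-1}$; if $v\in G_{t-1}^1$ and $v$ has a neighbor in $R_t$, then $v\in Y_t^s$; otherwise $v\in G_t^1$. The protocol clears $H$ if all vertices are green at time-step $N$. (For $H'$ the same rules are applied using adjacency in $H'$.) -}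

module Defs where

open import Data.Nat using (ℕ; zero; suc)
open import Data.Bool using (Bool; true; false; _∧_; not; if_then_else_)
open import Data.Fin using (Fin)
open import Data.List using (List; []; _∷_; map)
open import Data.Bool.ListAction using (any)
open import Data.Vec.Functional using (Vector)
open import Data.Product using (_×_)
open import Data.Unit using (⊤)
open import Data.Empty using (⊥)
open import Data.List.Base using (allFin)
open import Relation.Binary.PropositionalEquality using (_≡_)

record Graph (n : ℕ) : Set where
  field
    adj   : Fin n → Fin n → Bool
    sym   : ∀ u v → adj u v ≡ adj v u
    irrefl : ∀ v → adj v v ≡ false
open Graph public

-- A subgraph H' of H (on Fin n): a vertex subset V' ⊆ V(H) and a graph
-- H' whose edges are edges of H between vertices of V'.
-- Vertices outside V' are not vertices of H'.
record Subgraph {n : ℕ} (H : Graph n) : Set where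
  field
    verts   : Fin n → Bool
    graph   : Graph n
    edgeSub : ∀ u v → adj graph u v ≡ true →
              (adj H u v ≡ true) × (verts u ≡ true) × (verts v ≡ true)
open Subgraph public

-- States: G i (green, 1 ≤ i ≤ r), Y i (yellow, 1 ≤ i ≤ s), R (red).
data State : Set where
  G : ℕ → State
  Y : ℕ → State
  R : State

-- An (r,s)-protocol: the list (A_1, …, A_N) of immunized sets.
Protocol : ℕ → Set
Protocol n = List (Fin n → Bool)

-- v ∉ A_t and v was red or in Y^1 at time t-1  ⇔  v ∈ R_t
redNext : Bool → State → Bool
redNext true  _         = false
redNext false R         = true
redNext false (Y 1)     = true
redNext false _         = false

step : ∀ {n} → (r s : ℕ) → (Fin n → Fin n → Bool) →
       (Fin n → Bool) → (Fin n → State) → (Fin n → State)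
step {n} r s adj A prev v with A v
... | true  = G r
... | false with prev v
...   | R               = R
...   | Y 1             = R
...   | Y (suc (suc i)) = Y (suc i)
...   | Y 0             = R  -- unreachable
...   | G (suc (suc i)) = G (suc i)
...   | G 1             =
          if any (λ u → adj v u ∧ redNext (A u) (prev u)) (allFin n)
          then Y s else G 1
...   | G 0             = G 0  -- unreachable

run : ∀ {n} → (r s : ℕ) → (Fin n → Fin n → Bool) →
      (Fin n → State) → Protocol n → (Fin n → State)
run r s adj st []       = st
run r s adj st (A ∷ As) = run r s adj (step r s adj A st) As

allRed : ∀ {n} → Fin n → State
allRed _ = R

IsGreen : State → Set
IsGreen (G _) = ⊤
IsGreen (Y _) = ⊥
IsGreen R     = ⊥

Clears : ∀ {n} → (r s : ℕ) → Graph n → Protocol n → Set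
Clears r s H P = ∀ v → IsGreen (run r s (adj H) allRed P v)

ClearsSub : ∀ {n} {H : Graph n} → (r s : ℕ) → Subgraph H → Protocol n → Set
ClearsSub r s H' P =
  ∀ v → verts H' v ≡ true → IsGreen (run r s (adj (graph H')) allRed P v)

restrict : ∀ {n} {H : Graph n} → Subgraph H → Protocol n → Protocol n
restrict H' P = map (λ A v → A v ∧ verts H' v) P

module Submission where

-- Run the protocol on H and its restriction on H' side by side.  Every vertex
-- of H' is then always at least as safe in H' as in H: immunized vertices
-- agree, and a red neighbour in H' is a red neighbour in H, so an H'-vertex
-- turns yellow (or red) no earlier than in H.  A vertex green in H at the end
-- is therefore green in H'.

open import Data.Nat using (ℕ; suc; _≤_; _≥_; z≤n; s≤s)
open import Data.Nat.Properties using (≤-refl; ≤-trans; n≤1+n)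
open import Data.Bool using (Bool; true; false; _∧_; if_then_else_)
open import Data.Bool.Properties using (T-≡; ∧-conicalˡ; ∧-conicalʳ; ∧-identityʳ)
open import Data.Bool.ListAction using (any)
open import Data.Fin using (Fin)
open import Data.List using ([]; _∷_; allFin)
import Data.List.Relation.Unary.Any as Any
open import Data.List.Relation.Unary.Any.Properties using (any⁺; any⁻)
open import Data.Product using (_,_)
open import Data.Unit using (tt)
open import Function using (_∘_; Equivalence)
open import Relation.Binary.PropositionalEquality using (_≡_; refl; sym; trans; cong; subst; subst₂)
open import Defs hiding (sym)

open Equivalence using (to; from)

any-mono : ∀ {A : Set} {f g : A → Bool} → (∀ x → f x ≡ true → g x ≡ true) →
           ∀ xs → any f xs ≡ true → any g xs ≡ true
any-mono {f = f} {g} f⇒g xs =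
  to T-≡ ∘ any⁺ g ∘ Any.map (from T-≡ ∘ f⇒g _ ∘ to T-≡) ∘ any⁻ f xs ∘ from T-≡

hasRedNeighbour : ∀ {n} → (Fin n → Fin n → Bool) → (Fin n → Bool) →
                  (Fin n → State) → Fin n → Bool
hasRedNeighbour {n} adj A prev v = any (λ u → adj v u ∧ redNext (A u) (prev u)) (allFin n)

-- The rule for a vertex outside A_t; the Bool says whether it has a neighbour in R_t.
advance : ℕ → Bool → State → State
advance s _           R                 = R
advance s _           (Y 0)             = R
advance s _           (Y 1)             = R
advance s _           (Y (suc (suc i))) = Y (suc i)
advance s _           (G 0)             = G 0
advance s redNeighbour (G 1)            = if redNeighbour then Y s else G 1
advance s _           (G (suc (suc i))) = G (suc i)

step-immunized : ∀ {n} r s adj (A : Fin n → Bool) prev v →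
                 A v ≡ true → step r s adj A prev v ≡ G r
step-immunized r s adj A prev v Av with A v
step-immunized r s adj A prev v refl | true = refl

step-unimmunized : ∀ {n} r s adj (A : Fin n → Bool) prev v → A v ≡ false →
                   step r s adj A prev v ≡ advance s (hasRedNeighbour adj A prev v) (prev v)
step-unimmunized r s adj A prev v Av with A v
step-unimmunized r s adj A prev v refl | false with prev v
... | R               = refl
... | Y 0             = refl
... | Y 1             = refl
... | Y (suc (suc i)) = refl
... | G 0             = refl
... | G 1             = refl
... | G (suc (suc i)) = refl

-- h ≼[ s ] h' : a vertex in state h' is at least as safe as one in state h
-- (the same green state, a later turn to red, or h red).
data _≼[_]_ : State → ℕ → State → Set where
  green≼green   : ∀ {s} i → G i ≼[ s ] G i
  yellow≼green  : ∀ {s i} → 1 ≤ i → i ≤ s → Y i ≼[ s ] G 1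
  yellow≼yellow : ∀ {s i j} → 1 ≤ i → i ≤ s → i ≤ j → Y i ≼[ s ] Y j
  red≼          : ∀ {s} h → R ≼[ s ] h

≼-advance : ∀ {s h h'} {b b' : Bool} → s ≥ 1 → (b' ≡ true → b ≡ true) →
            h ≼[ s ] h' → advance s b h ≼[ s ] advance s b' h'
≼-advance _ _ (green≼green 0)             = green≼green 0
≼-advance _ _ (green≼green (suc (suc i))) = green≼green (suc i)
≼-advance {b = true}  {true}  s≥1 _    (green≼green 1) = yellow≼yellow s≥1 ≤-refl ≤-refl
≼-advance {b = true}  {false} s≥1 _    (green≼green 1) = yellow≼green s≥1 ≤-refl
≼-advance {b = false} {true}  _   b'⇒b (green≼green 1) with () ← b'⇒b refl
≼-advance {b = false} {false} _   _    (green≼green 1) = green≼green 1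
≼-advance _ _ (yellow≼green {i = 1} _ _) = red≼ _
≼-advance {b' = true}  _ _ (yellow≼green {i = suc (suc i)} _ 2+i≤s) =
  yellow≼yellow (s≤s z≤n) (≤-trans (n≤1+n _) 2+i≤s) (≤-trans (n≤1+n _) 2+i≤s)
≼-advance {b' = false} _ _ (yellow≼green {i = suc (suc i)} _ 2+i≤s) =
  yellow≼green (s≤s z≤n) (≤-trans (n≤1+n _) 2+i≤s)
≼-advance _ _ (yellow≼yellow {i = 1} _ _ _) = red≼ _
≼-advance _ _ (yellow≼yellow {i = suc (suc i)} {suc (suc j)} _ 2+i≤s (s≤s i≤j)) =
  yellow≼yellow (s≤s z≤n) (≤-trans (n≤1+n _) 2+i≤s) i≤j
≼-advance _ _ (red≼ h) = red≼ _

≼-redNext : ∀ {s h h'} b → h ≼[ s ] h' → redNext b h' ≡ true → redNext b h ≡ true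
≼-redNext true  _                                                  ()
≼-redNext false (red≼ _)                                           _ = refl
≼-redNext false (yellow≼yellow {i = 1} _ _ _)                      _ = refl
≼-redNext false (yellow≼yellow {i = suc (suc _)} {1} _ _ (s≤s ())) _

module _ {n} {H : Graph n} (H' : Subgraph H) (r s : ℕ) (s≥1 : s ≥ 1) where

  Dominated : (Fin n → State) → (Fin n → State) → Set
  Dominated st st' = ∀ v → verts H' v ≡ true → st v ≼[ s ] st' v

  restrictSet : (Fin n → Bool) → Fin n → Bool
  restrictSet A v = A v ∧ verts H' v

  restrictSet-≡ : (A : Fin n → Bool) → ∀ {v} → verts H' v ≡ true → restrictSet A v ≡ A v
  restrictSet-≡ A {v} v∈H' = trans (cong (A v ∧_) v∈H') (∧-identityʳ (A v))

  redNeighbour-restrict : ∀ {A st st'} → Dominated st st' → ∀ v u →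
    adj (graph H') v u ∧ redNext (restrictSet A u) (st' u) ≡ true →
    adj H v u ∧ redNext (A u) (st u) ≡ true
  redNeighbour-restrict {A} {st} {st'} dom v u red′
    with vu∈H , _ , u∈H' ← edgeSub H' v u (∧-conicalˡ _ _ red′) =
    trans (cong (_∧ redNext (A u) (st u)) vu∈H) (≼-redNext (A u) (dom u u∈H') red)
    where
    red : redNext (A u) (st' u) ≡ true
    red = subst (λ b → redNext b (st' u) ≡ true) (restrictSet-≡ A u∈H') (∧-conicalʳ _ _ red′)

  step-dominated : ∀ A {st st'} → Dominated st st' →
    Dominated (step r s (adj H) A st) (step r s (adj (graph H')) (restrictSet A) st')
  step-dominated A {st} {st'} dom v v∈H' = by-cases (A v) refl
    where
    st₁ st₁′ : Fin n → State
    st₁  = step r s (adj H) A st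
    st₁′ = step r s (adj (graph H')) (restrictSet A) st'
    by-cases : ∀ b → A v ≡ b → st₁ v ≼[ s ] st₁′ v
    by-cases true  Av = subst₂ _≼[ s ]_
      (sym (step-immunized r s _ A st v Av))
      (sym (step-immunized r s _ (restrictSet A) st' v (trans (restrictSet-≡ A v∈H') Av)))
      (green≼green r)
    by-cases false Av = subst₂ _≼[ s ]_
      (sym (step-unimmunized r s _ A st v Av))
      (sym (step-unimmunized r s _ (restrictSet A) st' v (trans (restrictSet-≡ A v∈H') Av)))
      (≼-advance s≥1 (any-mono (redNeighbour-restrict dom v) (allFin n)) (dom v v∈H'))

  run-dominated : ∀ P {st st'} → Dominated st st' →
    Dominated (run r s (adj H) st P) (run r s (adj (graph H')) st' (restrict H' P))
  run-dominated []      dom = dom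
  run-dominated (A ∷ P) dom = run-dominated P (step-dominated A dom)

≼-green : ∀ {s h h'} → h ≼[ s ] h' → IsGreen h → IsGreen h'
≼-green (green≼green i) _ = tt

theorem2p9 : ∀ {n} (H : Graph n) (r s : ℕ) → r ≥ 1 → s ≥ 1 →
    (P : Protocol n) → Clears r s H P →
    (H' : Subgraph H) → ClearsSub r s H' (restrict H' P)
theorem2p9 H r s _ s≥1 P clears H' v v∈H' =
  ≼-green (run-dominated H' r s s≥1 P (λ _ _ → red≼ R) v v∈H') (clears v)
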